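{- Let $c=d\ell$ with $(d,\ell)=1$. Then for all integers $h,n,m$, \begin{align*} \mathscr{S}(h,n,m;c,d)=d\cdot S(h,-n\overline{d}^2;\ell)\,T(n\overline{\ell},h\overline{\ell},m;d). \end{align*}
   Context: Write $\mathrm{e}(t)=\mathrm{e}^{2\pi it}$. For an integer $c\geqslant1$, $S(m,n;c)=\sum_{x\bmod c,\ (x,c)=1}\mathrm{e}\big(\frac{mx+n\overline{x}}{c}\big)$ is the classical Kloosterman sum, where $\overline{x}$ denotes the multiplicative inverse of $x$ modulo the relevant modulus. For $d\mid c$, define \[ \mathscr{S}(h,n,m;c,d)=\sum_{\substack{x\bmod c\\ (x,c)=1}}S(m,x;d)\,\mathrm{e}\Big(\frac{h\overline{x}-nx}{c}\Big), \] and define \[ T(a,b,m;c)=\frac{1}{c}\sum_{\substack{x\bmod c\\ (x,c)=1}}S(\overline{x}+a,-b;c)\,\mathrm{e}\Big(\frac{ -mx}{c}\Big). \] In the statement, $\overline{d}$ is the inverse of $d$ modulo $\ell$ and $\overline{\ell}$ is the inverse of $\ell$ modulo $d$. -}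

module Defs where

open import Level using (_⊔_)
open import Algebra.Bundles using (CommutativeRing)
open import Data.Nat as ℕ using (ℕ; zero; suc)
open import Data.Nat.DivMod as ND using ()
open import Data.Nat.GCD using (gcd)
open import Data.Integer as ℤ using (ℤ; +_)
open import Data.Integer.DivMod using (_%ℕ_)
open import Data.List using (List; []; _∷_; upTo; filter)
open import Data.Sum using (_⊎_)
open import Relation.Nullary using (yes; no)

-- Residue of an integer t modulo N, as a natural number in [0, N).
-- (Junk value 0 for N = 0, never used.)
resℤ : ℤ → ℕ → ℕ
resℤ t zero    = 0
resℤ t (suc k) = t %ℕ suc k

-- Multiplicative inverse of x modulo N: the least y < N with x*y ≡ 1 (mod N).
-- (Junk value 0 if x is not a unit mod N; only used for units.)
invℕ : ℕ → ℕ → ℕ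
invℕ zero    x = 0
invℕ (suc k) x = go (upTo (suc k))
  where
  go : List ℕ → ℕ
  go []       = 0
  go (y ∷ ys) with (x ℕ.* y) ND.% suc k ℕ.≟ 1 ND.% suc k
  ... | yes _ = y
  ... | no  _ = go ys

units : ℕ → List ℕ
units N = filter (λ x → gcd x N ℕ.≟ 1) (upTo N)

divℕ : ℕ → ℕ → ℕ
divℕ a zero    = 0
divℕ a (suc k) = a ND./ suc k

module _ {a b} (R : CommutativeRing a b) where
  open CommutativeRing R

  pow : Carrier → ℕ → Carrier
  pow x zero    = 1#
  pow x (suc k) = x * pow x k

  NoZeroDivisors : Set (a ⊔ b)
  NoZeroDivisors = ∀ x y → x * y ≈ 0# → x ≈ 0# ⊎ y ≈ 0#

  -- ζ is a root of unity of exact order C in R (plays the role of e(1/C)).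
  ExactOrder : Carrier → ℕ → Set b
  ExactOrder ζ C = (pow ζ C ≈ 1#) Data.Product.× (∀ k → 0 ℕ.< k → k ℕ.< C → ¬ (pow ζ k ≈ 1#))
    where open import Data.Product
          open import Relation.Nullary using (¬_)

  sumL : List ℕ → (ℕ → Carrier) → Carrier
  sumL []       f = 0#
  sumL (x ∷ xs) f = f x + sumL xs f

  module Exp (ζ : Carrier) (C : ℕ) where

    -- e(t/N) for N ∣ C: equals ζ^{(C/N)·(t mod N)}.
    e : ℤ → ℕ → Carrier
    e t N = pow ζ (divℕ C N ℕ.* resℤ t N)

    inv : ℕ → ℕ → ℤ
    inv N x = + invℕ N x

    S : ℤ → ℤ → ℕ → Carrier
    S m n N = sumL (units N) (λ x → e (m ℤ.* + x ℤ.+ n ℤ.* inv N x) N)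

    𝒮 : ℤ → ℤ → ℤ → ℕ → ℕ → Carrier
    𝒮 h n m c d = sumL (units c) (λ x →
      S m (+ x) d * e (h ℤ.* inv c x ℤ.- n ℤ.* + x) c)

    -- cT(a,b,m;c) = c · T(a,b,m;c) = Σ_{x mod c, (x,c)=1} S(x̄ + a, −b; c) e(−m x / c)
    cT : ℤ → ℤ → ℤ → ℕ → Carrier
    cT a' b' m N = sumL (units N) (λ x →
      S (inv N x ℤ.+ a') (ℤ.- b') N * e (ℤ.- (m ℤ.* + x)) N)

-- Split x mod c = dℓ by the Chinese remainder theorem into (a mod ℓ, b mod d) and expand
-- S(m, x; d) as a sum over y mod d. Every phase is then a power of ζ, so both sides become triple
-- sums of E(t) = ζ^(t mod c) = e(t/c), and it suffices to match their exponents term by term.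
-- After the substitution u = d̄ā (mod ℓ), x′ = −y, y′ = −b on the right-hand side, the exponents
-- agree modulo ℓ (both are hā − na) and modulo d (both are ℓ(my + bȳ) + hb̄ − nb), hence modulo c.

module Submission where

open import Defs
open import Algebra.Bundles using (CommutativeRing)
open import Data.Nat as ℕ using (ℕ)
open import Data.Nat.Coprimality using (Coprime)
open import Data.Integer as ℤ using (ℤ; +_)

open import Data.Nat.Base using (zero; suc; NonZero; >-nonZero)
import Data.Nat.Properties as ℕP
import Data.Nat.Divisibility as ℕD
import Data.Nat.DivMod as ℕDM
open import Data.Nat.GCD using (gcd; module Bézout)
open import Data.Nat.LCM using (lcm; lcm-least; gcd*lcm)
import Data.Nat.Coprimality as CP
open import Data.Nat.Coprimality using (coprime⇒gcd≡1; gcd≡1⇒coprime; coprime-Bézout)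
open import Data.Integer.Base using (∣_∣)
import Data.Integer.Properties as ℤP
open import Data.Integer.Divisibility.Signed
  using ( _∣_; divides; ∣-trans; ∣ᵤ⇒∣; ∣⇒∣ᵤ; ∣m∣n⇒∣m+n; ∣m∣n⇒∣m-n; ∣m⇒∣-m; ∣m⇒∣m*n; ∣n⇒∣m*n
        ; *-monoʳ-∣)
open import Data.Integer.DivMod using (n%ℕd<d; a≡a%ℕn+[a/ℕn]*n)
open import Data.Integer.Tactic.RingSolver using (solve; solve-∀)
open import Data.List.Base using (List; []; _∷_; _++_; map; foldr; upTo; applyUpTo; cartesianProduct)
open import Data.List.Properties using (map-∘; map-id-local)
open import Data.List.Membership.Propositional using (_∈_; lose)
open import Data.List.Membership.Propositional.Properties
  using ( ∈-upTo⁺; ∈-upTo⁻; ∈-filter⁺; ∈-filter⁻; ∈-map⁺; ∈-map⁻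
        ; ∈-cartesianProduct⁺; ∈-cartesianProduct⁻)
open import Data.List.Membership.Propositional.Properties.WithK using (unique∧set⇒bag)
open import Data.List.Relation.Unary.Any using (Any; here; there)
import Data.List.Relation.Unary.All as All
open import Data.List.Relation.Unary.Unique.Propositional using (Unique)
open import Data.List.Relation.Unary.Unique.Propositional.Properties
  using (filter⁺; upTo⁺; map⁻; cartesianProduct⁺)
open import Data.List.Relation.Binary.BagAndSetEquality using (∼bag⇒↭)
open import Data.List.Relation.Binary.Permutation.Propositional using (_↭_; ↭-sym; ↭⇒↭ₛ′)
open import Data.List.Relation.Binary.Permutation.Propositional.Properties using () renaming (map⁺ to ↭-map⁺)
open import Data.Product.Base as Product using (∃-syntax; _×_; _,_; proj₁; proj₂)
open import Data.Sum.Base using (inj₁; inj₂)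
open import Function.Base using (_∘_)
open import Function.Bundles using (mk⇔)
open import Relation.Binary.Bundles using (Setoid)
open import Relation.Binary.PropositionalEquality
  using (_≡_; refl; sym; trans; cong; cong₂; subst; subst₂; module ≡-Reasoning)
open import Relation.Nullary.Decidable using (yes; no)
open import Relation.Nullary.Negation using (contradiction)

module Congruence where

  open import Data.Integer.Base using (0ℤ; 1ℤ; _+_; _*_; _-_; -_)

  infix 4 _≡_mod_

  -- A record rather than the divisibility itself, so that a and b can be inferred from proofs.
  record _≡_mod_ (a b : ℤ) (N : ℕ) : Set where
    constructor congruent
    field modulus∣difference : + N ∣ a - b

  private
    ∣-resp-≡ : ∀ {k i j} → k ∣ i → i ≡ j → k ∣ j
    ∣-resp-≡ p refl = p

  module _ {N : ℕ} where

    ≡-mod-reflexive : ∀ {a b} → a ≡ b → a ≡ b mod N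
    ≡-mod-reflexive {a} refl = congruent (divides 0ℤ (ℤP.+-inverseʳ a))

    ≡-mod-refl : ∀ {a} → a ≡ a mod N
    ≡-mod-refl = ≡-mod-reflexive refl

    ≡-mod-sym : ∀ {a b} → a ≡ b mod N → b ≡ a mod N
    ≡-mod-sym {a} {b} (congruent p) = congruent (∣-resp-≡ (∣m⇒∣-m p) (solve (a ∷ b ∷ [])))

    ≡-mod-trans : ∀ {a b c} → a ≡ b mod N → b ≡ c mod N → a ≡ c mod N
    ≡-mod-trans {a} {b} {c} (congruent p) (congruent q) =
      congruent (∣-resp-≡ (∣m∣n⇒∣m+n p q) (solve (a ∷ b ∷ c ∷ [])))

    ≡-mod-setoid : Setoid _ _
    ≡-mod-setoid = record
      { Carrier       = ℤ
      ; _≈_           = λ a b → a ≡ b mod N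
      ; isEquivalence = record { refl = ≡-mod-refl ; sym = ≡-mod-sym ; trans = ≡-mod-trans }
      }

    +-cong-mod : ∀ {a b c d} → a ≡ b mod N → c ≡ d mod N → a + c ≡ b + d mod N
    +-cong-mod {a} {b} {c} {d} (congruent p) (congruent q) =
      congruent (∣-resp-≡ (∣m∣n⇒∣m+n p q) (solve (a ∷ b ∷ c ∷ d ∷ [])))

    *-cong-mod : ∀ {a b c d} → a ≡ b mod N → c ≡ d mod N → a * c ≡ b * d mod N
    *-cong-mod {a} {b} {c} {d} (congruent p) (congruent q) = congruent
      (∣-resp-≡ (∣m∣n⇒∣m+n (∣m⇒∣m*n c p) (∣n⇒∣m*n b q)) (solve (a ∷ b ∷ c ∷ d ∷ [])))

    neg-cong-mod : ∀ {a b} → a ≡ b mod N → - a ≡ - b mod N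
    neg-cong-mod {a} {b} (congruent p) = congruent (∣-resp-≡ (∣m⇒∣-m p) (solve (a ∷ b ∷ [])))

    -‿cong-mod : ∀ {a b c d} → a ≡ b mod N → c ≡ d mod N → a - c ≡ b - d mod N
    -‿cong-mod p q = +-cong-mod p (neg-cong-mod q)

    +-congˡ-mod : ∀ a {b c} → b ≡ c mod N → a + b ≡ a + c mod N
    +-congˡ-mod a = +-cong-mod (≡-mod-refl {a})

    +-congʳ-mod : ∀ a {b c} → b ≡ c mod N → b + a ≡ c + a mod N
    +-congʳ-mod a p = +-cong-mod p (≡-mod-refl {a})

    *-congˡ-mod : ∀ a {b c} → b ≡ c mod N → a * b ≡ a * c mod N
    *-congˡ-mod a = *-cong-mod (≡-mod-refl {a})

    *-congʳ-mod : ∀ a {b c} → b ≡ c mod N → b * a ≡ c * a mod N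
    *-congʳ-mod a p = *-cong-mod p (≡-mod-refl {a})

    -‿congˡ-mod : ∀ a {b c} → b ≡ c mod N → a - b ≡ a - c mod N
    -‿congˡ-mod a = -‿cong-mod (≡-mod-refl {a})

    modulus≡0 : + N ≡ 0ℤ mod N
    modulus≡0 = congruent (divides 1ℤ (trans (ℤP.+-identityʳ (+ N)) (sym (ℤP.*-identityˡ (+ N)))))

  module ≡-mod-Reasoning (N : ℕ) where
    open import Relation.Binary.Reasoning.Setoid (≡-mod-setoid {N}) public

  ≡-mod-∣ : ∀ {M N a b} → M ℕD.∣ N → a ≡ b mod N → a ≡ b mod M
  ≡-mod-∣ M∣N (congruent p) = congruent (∣-trans (∣ᵤ⇒∣ M∣N) p)

  coprime-∣-* : ∀ {d ℓ k} → Coprime d ℓ → d ℕD.∣ k → ℓ ℕD.∣ k → d ℕ.* ℓ ℕD.∣ k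
  coprime-∣-* {d} {ℓ} d⊥ℓ d∣k ℓ∣k = subst (ℕD._∣ _) lcm≡d*ℓ (lcm-least d∣k ℓ∣k)
    where
    lcm≡d*ℓ : lcm d ℓ ≡ d ℕ.* ℓ
    lcm≡d*ℓ = begin
      lcm d ℓ            ≡⟨ ℕP.*-identityˡ (lcm d ℓ) ⟨
      1 ℕ.* lcm d ℓ      ≡⟨ cong (ℕ._* lcm d ℓ) (coprime⇒gcd≡1 d⊥ℓ) ⟨
      gcd d ℓ ℕ.* lcm d ℓ  ≡⟨ gcd*lcm d ℓ ⟩
      d ℕ.* ℓ            ∎
      where open ≡-Reasoning

  ≡-mod-crt : ∀ {d ℓ a b} → Coprime d ℓ → a ≡ b mod d → a ≡ b mod ℓ → a ≡ b mod (d ℕ.* ℓ)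
  ≡-mod-crt d⊥ℓ (congruent p) (congruent q) =
    congruent (∣ᵤ⇒∣ (coprime-∣-* d⊥ℓ (∣⇒∣ᵤ p) (∣⇒∣ᵤ q)))

  ≡-mod-scale : ∀ {N a b} q → a ≡ b mod N → + q * a ≡ + q * b mod (q ℕ.* N)
  ≡-mod-scale {N} {a} {b} q (congruent p) =
    congruent (subst₂ _∣_ (sym (ℤP.pos-* q N)) (distrib (+ q) a b) (*-monoʳ-∣ (+ q) p))
    where
    distrib : ∀ k a b → k * (a - b) ≡ k * a - k * b
    distrib = solve-∀


  +-multiple≡ : ∀ {N} a q → a + q * + N ≡ a mod N
  +-multiple≡ {N} a q = congruent (divides q (cancel a q (+ N)))
    where
    cancel : ∀ a q n → a + q * n - a ≡ q * n
    cancel = solve-∀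

  ℕ-multiple≡ : ∀ {N} a q → + (a ℕ.+ q ℕ.* N) ≡ + a mod N
  ℕ-multiple≡ {N} a q = ≡-mod-trans
    (≡-mod-reflexive (trans (ℤP.pos-+ a (q ℕ.* N)) (cong (λ t → + a + t) (ℤP.pos-* q N))))
    (+-multiple≡ (+ a) (+ q))

open Congruence

m<n∧n∣m⇒m≡0 : ∀ {m n} → m ℕ.< n → n ℕD.∣ m → m ≡ 0
m<n∧n∣m⇒m≡0 {zero}  _   _   = refl
m<n∧n∣m⇒m≡0 {suc m} m<n n∣m = contradiction n∣m (ℕD.>⇒∤ m<n)

residue-unique-≤ : ∀ {N r s} → r ℕ.≤ s → s ℕ.< N → + r ≡ + s mod N → r ≡ s
residue-unique-≤ {N} {r} {s} r≤s s<N (congruent p) =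
  ℕP.≤-antisym r≤s (ℕP.m∸n≡0⇒m≤n (m<n∧n∣m⇒m≡0 (ℕP.≤-<-trans (ℕP.m∸n≤m s r) s<N) N∣s∸r))
  where
  N∣s∸r : N ℕD.∣ s ℕ.∸ r
  N∣s∸r = subst (N ℕD.∣_) (trans (cong ∣_∣ (ℤP.[+m]-[+n]≡m⊖n r s)) (ℤP.∣⊖∣-≤ r≤s))
                (∣⇒∣ᵤ p)

residue-unique : ∀ {N r s} → r ℕ.< N → s ℕ.< N → + r ≡ + s mod N → r ≡ s
residue-unique {r = r} {s} r<N s<N r≡s with ℕP.≤-total r s
... | inj₁ r≤s = residue-unique-≤ r≤s s<N r≡s
... | inj₂ s≤r = sym (residue-unique-≤ s≤r r<N (≡-mod-sym r≡s))

resℤ-< : ∀ {N} .{{_ : NonZero N}} t → resℤ t N ℕ.< N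
resℤ-< {suc k} t = n%ℕd<d t (suc k)

resℤ≡ : ∀ {N} .{{_ : NonZero N}} t → + resℤ t N ≡ t mod N
resℤ≡ {suc k} t =
  ≡-mod-trans (≡-mod-sym (+-multiple≡ _ (t ℤ./ℕ suc k))) (≡-mod-reflexive (sym (a≡a%ℕn+[a/ℕn]*n t (suc k))))

module _ {N : ℕ} .{{_ : NonZero N}} where

  resℤ-unique : ∀ {r t} → r ℕ.< N → + r ≡ t mod N → resℤ t N ≡ r
  resℤ-unique {t = t} r<N r≡t = residue-unique (resℤ-< t) r<N (≡-mod-trans (resℤ≡ t) (≡-mod-sym r≡t))

  resℤ-cong : ∀ {s t} → s ≡ t mod N → resℤ s N ≡ resℤ t N
  resℤ-cong {s} {t} s≡t = resℤ-unique (resℤ-< t) (≡-mod-trans (resℤ≡ t) (≡-mod-sym s≡t))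

module Inverses where

  open import Data.Integer.Base using (1ℤ; _+_; _*_; _-_; -_)

  coprime⇒invertible : ∀ {x N} → Coprime x N → ∃[ w ] + x * w ≡ 1ℤ mod N
  coprime⇒invertible {x} {N} x⊥N with coprime-Bézout x⊥N
  ... | Bézout.+- u v 1+vN≡ux = + u , (begin
    + x * + u          ≡⟨ trans (sym (ℤP.pos-* x u)) (cong +_ (ℕP.*-comm x u)) ⟩
    + (u ℕ.* x)        ≡⟨ cong +_ 1+vN≡ux ⟨
    + (1 ℕ.+ v ℕ.* N)  ≈⟨ ℕ-multiple≡ 1 v ⟩
    1ℤ                 ∎)
    where open ≡-mod-Reasoning N
  ... | Bézout.-+ u v 1+ux≡vN = - + u , (begin
    + x * - + u                ≡⟨ rearrange (+ x) (+ u) ⟩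
    1ℤ - (1ℤ + + u * + x)      ≡⟨ cong (λ t → 1ℤ - (1ℤ + t)) (ℤP.pos-* u x) ⟨
    1ℤ - + (1 ℕ.+ u ℕ.* x)     ≡⟨ cong (λ t → 1ℤ - + t) 1+ux≡vN ⟩
    1ℤ - + (v ℕ.* N)           ≈⟨ -‿congˡ-mod 1ℤ (ℕ-multiple≡ 0 v) ⟩
    1ℤ                         ∎)
    where
    open ≡-mod-Reasoning N
    rearrange : ∀ x u → x * - u ≡ 1ℤ - (1ℤ + u * x)
    rearrange = solve-∀

  invertible⇒coprime : ∀ {x N w} → + x * w ≡ 1ℤ mod N → Coprime x N
  invertible⇒coprime {x} {N} {w} (congruent N∣xw-1) {i} (i∣x , i∣N) = ℕD.∣1⇒≡1 (∣⇒∣ᵤ i∣1)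
    where
    difference : ∀ a → a - (a - 1ℤ) ≡ 1ℤ
    difference = solve-∀
    i∣xw : + i ∣ + x * w
    i∣xw = ∣m⇒∣m*n w (∣ᵤ⇒∣ {+ i} {+ x} i∣x)
    i∣xw-1 : + i ∣ + x * w - 1ℤ
    i∣xw-1 = ∣-trans (∣ᵤ⇒∣ {+ i} {+ N} i∣N) N∣xw-1
    i∣1 : + i ∣ 1ℤ
    i∣1 = subst (+ i ∣_) (difference (+ x * w)) (∣m∣n⇒∣m-n i∣xw i∣xw-1)

  inverse-unique : ∀ {N a b u v} → a ≡ b mod N → a * u ≡ 1ℤ mod N → b * v ≡ 1ℤ mod N → u ≡ v mod N
  inverse-unique {N} {a} {b} {u} {v} a≡b au≡1 bv≡1 = begin
    u              ≡⟨ ℤP.*-identityʳ u ⟨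
    u * 1ℤ         ≈⟨ *-congˡ-mod u (≡-mod-sym bv≡1) ⟩
    u * (b * v)    ≈⟨ *-congˡ-mod u (*-congʳ-mod v (≡-mod-sym a≡b)) ⟩
    u * (a * v)    ≡⟨ solve (u ∷ a ∷ v ∷ []) ⟩
    (a * u) * v    ≈⟨ *-congʳ-mod v au≡1 ⟩
    1ℤ * v         ≡⟨ ℤP.*-identityˡ v ⟩
    v              ∎
    where open ≡-mod-Reasoning N

  module InverseSearch (k x : ℕ) where

    IsInverse : ℕ → Set
    IsInverse y = (x ℕ.* y) ℕ.% suc k ≡ 1 ℕ.% suc k

    mutual
      private
        -- The anonymous search function in the definition of invℕ,
        -- recovered by unification in the no-branch of invℕ-found.
        search : List ℕ → ℕ
        search = _

      invℕ-found : Any IsInverse (upTo (suc k)) →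
                   invℕ (suc k) x ∈ upTo (suc k) × IsInverse (invℕ (suc k) x)
      invℕ-found with (x ℕ.* 0) ℕ.% suc k ℕ.≟ 1 ℕ.% suc k
      ... | yes inverse₀ = λ _ → here refl , inverse₀
      ... | no ¬inverse₀ with applyUpTo suc k
      ...   | ys = λ { (here inverse₀) → contradiction inverse₀ ¬inverse₀
                     ; (there found) → Product.map₁ there (search-finds ys found) }

      private
        search-finds : ∀ ys → Any IsInverse ys → search ys ∈ ys × IsInverse (search ys)
        search-finds (y ∷ ys) found with (x ℕ.* y) ℕ.% suc k ℕ.≟ 1 ℕ.% suc k
        search-finds (y ∷ ys) found          | yes inverse = here refl , inverse
        search-finds (y ∷ ys) (here inverse) | no ¬inverse = contradiction inverse ¬inverse
        search-finds (y ∷ ys) (there found)  | no ¬inverse = Product.map₁ there (search-finds ys found)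

  invℕ-spec : ∀ {N x} .{{_ : NonZero N}} → Coprime x N → invℕ N x ℕ.< N × + x * + invℕ N x ≡ 1ℤ mod N
  invℕ-spec {suc k} {x} x⊥N =
    Product.map ∈-upTo⁻ from-IsInverse (invℕ-found (lose (∈-upTo⁺ (resℤ-< w)) (to-IsInverse xy≡1)))
    where
    open InverseSearch k x
    open ≡-mod-Reasoning (suc k)
    w = proj₁ (coprime⇒invertible x⊥N)
    xy≡1 : + x * + resℤ w (suc k) ≡ 1ℤ mod suc k
    xy≡1 = ≡-mod-trans (*-congˡ-mod (+ x) (resℤ≡ w)) (proj₂ (coprime⇒invertible x⊥N))
    to-IsInverse : ∀ {y} → + x * + y ≡ 1ℤ mod suc k → IsInverse y
    to-IsInverse {y} xy≡1 = resℤ-cong (≡-mod-trans (≡-mod-reflexive (ℤP.pos-* x y)) xy≡1)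
    from-IsInverse : ∀ {y} → IsInverse y → + x * + y ≡ 1ℤ mod suc k
    from-IsInverse {y} inverse = begin
      + x * + y                     ≡⟨ ℤP.pos-* x y ⟨
      + (x ℕ.* y)                   ≈⟨ resℤ≡ (+ (x ℕ.* y)) ⟨
      + resℤ (+ (x ℕ.* y)) (suc k)  ≡⟨ cong +_ inverse ⟩
      + resℤ 1ℤ (suc k)             ≈⟨ resℤ≡ 1ℤ ⟩
      1ℤ                            ∎

  ∈-units⁻ : ∀ {N x} → x ∈ units N → x ℕ.< N × Coprime x N
  ∈-units⁻ {N} x∈units =
    Product.map ∈-upTo⁻ gcd≡1⇒coprime (∈-filter⁻ (λ x → gcd x N ℕ.≟ 1) x∈units)

  ∈-units⁺ : ∀ {N x} → x ℕ.< N → Coprime x N → x ∈ units N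
  ∈-units⁺ {N} x<N x⊥N = ∈-filter⁺ (λ x → gcd x N ℕ.≟ 1) (∈-upTo⁺ x<N) (coprime⇒gcd≡1 x⊥N)

  units-unique : ∀ N → Unique (units N)
  units-unique N = filter⁺ (λ x → gcd x N ℕ.≟ 1) (upTo⁺ N)

  module _ {N : ℕ} .{{_ : NonZero N}} {x : ℕ} (x∈units : x ∈ units N) where

    unit-< : x ℕ.< N
    unit-< = proj₁ (∈-units⁻ x∈units)

    unit-inverse : + x * + invℕ N x ≡ 1ℤ mod N
    unit-inverse = proj₂ (invℕ-spec (proj₂ (∈-units⁻ x∈units)))

  resℤ∈units : ∀ {N t w} .{{_ : NonZero N}} → t * w ≡ 1ℤ mod N → resℤ t N ∈ units N
  resℤ∈units {t = t} tw≡1 =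
    ∈-units⁺ (resℤ-< t) (invertible⇒coprime (≡-mod-trans (*-cong-mod (resℤ≡ t) ≡-mod-refl) tw≡1))

open Inverses

record ListBijection {A B : Set} (xs : List A) (ys : List B) : Set where
  field
    to      : A → B
    from    : B → A
    to-∈    : ∀ {x} → x ∈ xs → to x ∈ ys
    from-∈  : ∀ {y} → y ∈ ys → from y ∈ xs
    from∘to : ∀ {x} → x ∈ xs → from (to x) ≡ x
    to∘from : ∀ {y} → y ∈ ys → to (from y) ≡ y

involution : ∀ {A : Set} {xs : List A} (f : A → A) →
             (∀ {x} → x ∈ xs → f x ∈ xs) → (∀ {x} → x ∈ xs → f (f x) ≡ x) → ListBijection xs xs
involution f f-∈ f∘f = record
  { to = f ; from = f ; to-∈ = f-∈ ; from-∈ = f-∈ ; from∘to = f∘f ; to∘from = f∘f }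

map-to-↭ : ∀ {A B : Set} {xs : List A} {ys : List B} → Unique xs → Unique ys →
           (bij : ListBijection xs ys) → map (ListBijection.to bij) xs ↭ ys
map-to-↭ {xs = xs} {ys} xs! ys! bij = ∼bag⇒↭ (unique∧set⇒bag image! ys! (mk⇔ image⊆ys ys⊆image))
  where
  open ListBijection bij
  image! : Unique (map to xs)
  image! = map⁻ {f = from} (subst Unique (sym from∘to-on-xs) xs!)
    where from∘to-on-xs = trans (sym (map-∘ xs)) (map-id-local (All.tabulate from∘to))
  image⊆ys : ∀ {y} → y ∈ map to xs → y ∈ ys
  image⊆ys y∈image with x , x∈xs , refl ← ∈-map⁻ to y∈image = to-∈ x∈xs
  ys⊆image : ∀ {y} → y ∈ ys → y ∈ map to xs
  ys⊆image y∈ys = subst (_∈ map to xs) (to∘from y∈ys) (∈-map⁺ to (from-∈ y∈ys))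

module UnitPermutations (N : ℕ) .{{_ : NonZero N}} where

  open import Data.Integer.Base using (1ℤ; _*_; -_)
  open ≡-mod-Reasoning N

  negate : ℕ → ℕ
  negate y = resℤ (- + y) N

  module _ {y : ℕ} (y∈units : y ∈ units N) where

    private
      neg*neg : ∀ a b → - a * - b ≡ a * b
      neg*neg = solve-∀

      negated-inverse : - + y * - + invℕ N y ≡ 1ℤ mod N
      negated-inverse = ≡-mod-trans (≡-mod-reflexive (neg*neg (+ y) _)) (unit-inverse y∈units)

    negate-∈ : negate y ∈ units N
    negate-∈ = resℤ∈units negated-inverse

    negate-inverse : + invℕ N (negate y) ≡ - + invℕ N y mod N
    negate-inverse = inverse-unique (resℤ≡ (- + y)) (unit-inverse negate-∈) negated-inverse

    negate-involutive : negate (negate y) ≡ y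
    negate-involutive = resℤ-unique (unit-< y∈units) (begin
      + y               ≡⟨ ℤP.neg-involutive (+ y) ⟨
      - - + y           ≈⟨ neg-cong-mod (resℤ≡ (- + y)) ⟨
      - + negate y      ∎)

  negate-bijection : ListBijection (units N) (units N)
  negate-bijection = involution negate negate-∈ negate-involutive

  module _ (k k⁻¹ : ℤ) (kk⁻¹≡1 : k * k⁻¹ ≡ 1ℤ mod N) where

    scaledInverse : ℕ → ℕ
    scaledInverse a = resℤ (k⁻¹ * + invℕ N a) N

    module _ {a : ℕ} (a∈units : a ∈ units N) where

      private
        rearrange : ∀ k k⁻¹ a a⁻¹ → (k⁻¹ * a⁻¹) * (k * a) ≡ (k * k⁻¹) * (a * a⁻¹)
        rearrange = solve-∀

        scaled-inverse : (k⁻¹ * + invℕ N a) * (k * + a) ≡ 1ℤ mod N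
        scaled-inverse = begin
          (k⁻¹ * + invℕ N a) * (k * + a)   ≡⟨ rearrange k k⁻¹ (+ a) _ ⟩
          (k * k⁻¹) * (+ a * + invℕ N a)   ≈⟨ *-cong-mod kk⁻¹≡1 (unit-inverse a∈units) ⟩
          1ℤ                               ∎

      scaledInverse-∈ : scaledInverse a ∈ units N
      scaledInverse-∈ = resℤ∈units scaled-inverse

      scaledInverse-inverse : + invℕ N (scaledInverse a) ≡ k * + a mod N
      scaledInverse-inverse = inverse-unique (resℤ≡ _) (unit-inverse scaledInverse-∈) scaled-inverse

      scaledInverse-involutive : scaledInverse (scaledInverse a) ≡ a
      scaledInverse-involutive = resℤ-unique (unit-< a∈units) (begin
        + a                                   ≡⟨ ℤP.*-identityˡ (+ a) ⟨
        1ℤ * + a                              ≈⟨ *-congʳ-mod (+ a) kk⁻¹≡1 ⟨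
        (k * k⁻¹) * + a                       ≡⟨ regroup k k⁻¹ (+ a) ⟩
        k⁻¹ * (k * + a)                       ≈⟨ *-congˡ-mod k⁻¹ scaledInverse-inverse ⟨
        k⁻¹ * + invℕ N (scaledInverse a)      ∎)
        where
        regroup : ∀ k k⁻¹ a → (k * k⁻¹) * a ≡ k⁻¹ * (k * a)
        regroup = solve-∀

    scaledInverse-bijection : ListBijection (units N) (units N)
    scaledInverse-bijection = involution scaledInverse scaledInverse-∈ scaledInverse-involutive

open UnitPermutations

module Sums {c ℓ} (R : CommutativeRing c ℓ) where

  open CommutativeRing R renaming (refl to ≈-refl; sym to ≈-sym; trans to ≈-trans; reflexive to ≈-reflexive)
  open import Relation.Binary.Reasoning.Setoid setoid
  open import Algebra.Properties.CommutativeSemigroup +-commutativeSemigroup using (interchange)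

  ∑ : {A : Set} → List A → (A → Carrier) → Carrier
  ∑ xs f = foldr _+_ 0# (map f xs)

  syntax ∑ xs (λ x → e) = ∑[ x ∈ xs ] e

  sumL≡∑ : ∀ xs f → sumL R xs f ≡ ∑ xs f
  sumL≡∑ []       f = refl
  sumL≡∑ (x ∷ xs) f = cong (λ s → f x + s) (sumL≡∑ xs f)

  module _ {A : Set} where

    ∑-cong : ∀ (xs : List A) {f g} → (∀ {x} → x ∈ xs → f x ≈ g x) → ∑ xs f ≈ ∑ xs g
    ∑-cong []       f≈g = ≈-refl
    ∑-cong (x ∷ xs) f≈g = +-cong (f≈g (here refl)) (∑-cong xs (f≈g ∘ there))

    ∑-0 : ∀ (xs : List A) → ∑[ x ∈ xs ] 0# ≈ 0#
    ∑-0 []       = ≈-refl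
    ∑-0 (x ∷ xs) = ≈-trans (+-identityˡ _) (∑-0 xs)

    ∑-+ : ∀ (xs : List A) f g → ∑[ x ∈ xs ] (f x + g x) ≈ ∑ xs f + ∑ xs g
    ∑-+ []       f g = ≈-sym (+-identityˡ 0#)
    ∑-+ (x ∷ xs) f g = ≈-trans (+-congˡ (∑-+ xs f g)) (interchange (f x) (g x) _ _)

    ∑-*ˡ : ∀ (xs : List A) f a → a * ∑ xs f ≈ ∑[ x ∈ xs ] (a * f x)
    ∑-*ˡ []       f a = zeroʳ a
    ∑-*ˡ (x ∷ xs) f a = ≈-trans (distribˡ a (f x) _) (+-congˡ (∑-*ˡ xs f a))

    ∑-*ʳ : ∀ (xs : List A) f a → ∑ xs f * a ≈ ∑[ x ∈ xs ] (f x * a)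
    ∑-*ʳ []       f a = zeroˡ a
    ∑-*ʳ (x ∷ xs) f a = ≈-trans (distribʳ a (f x) _) (+-congˡ (∑-*ʳ xs f a))

    ∑-++ : ∀ (xs ys : List A) f → ∑ (xs ++ ys) f ≈ ∑ xs f + ∑ ys f
    ∑-++ []       ys f = ≈-sym (+-identityˡ _)
    ∑-++ (x ∷ xs) ys f = ≈-trans (+-congˡ (∑-++ xs ys f)) (≈-sym (+-assoc (f x) _ _))

    ∑-↭ : ∀ {xs ys : List A} f → xs ↭ ys → ∑ xs f ≈ ∑ ys f
    ∑-↭ f xs↭ys = foldr-commMonoid +-isCommutativeMonoid (↭⇒↭ₛ′ isEquivalence (↭-map⁺ f xs↭ys))
      where open import Data.List.Relation.Binary.Permutation.Setoid.Properties setoid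
              using (foldr-commMonoid)

  ∑-map : ∀ {A B : Set} (xs : List A) (g : A → B) f → ∑ (map g xs) f ≡ ∑[ x ∈ xs ] f (g x)
  ∑-map xs g f = cong (foldr _+_ 0#) (sym (map-∘ xs))

  ∑-comm : ∀ {A B : Set} (xs : List A) (ys : List B) (f : A → B → Carrier) →
           ∑[ x ∈ xs ] ∑[ y ∈ ys ] f x y ≈ ∑[ y ∈ ys ] ∑[ x ∈ xs ] f x y
  ∑-comm []       ys f = ≈-sym (∑-0 ys)
  ∑-comm (x ∷ xs) ys f =
    ≈-trans (+-congˡ (∑-comm xs ys f)) (≈-sym (∑-+ ys (f x) (λ y → ∑[ x ∈ xs ] f x y)))

  ∑-cartesianProduct : ∀ {A B : Set} (xs : List A) (ys : List B) f →
                       ∑ (cartesianProduct xs ys) f ≈ ∑[ x ∈ xs ] ∑[ y ∈ ys ] f (x , y)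
  ∑-cartesianProduct []       ys f = ≈-refl
  ∑-cartesianProduct (x ∷ xs) ys f = begin
    ∑ (map (x ,_) ys ++ cartesianProduct xs ys) f          ≈⟨ ∑-++ (map (x ,_) ys) _ f ⟩
    ∑ (map (x ,_) ys) f + ∑ (cartesianProduct xs ys) f     ≈⟨ +-cong (≈-reflexive (∑-map ys (x ,_) f))
                                                                      (∑-cartesianProduct xs ys f) ⟩
    ∑[ y ∈ ys ] f (x , y) + ∑[ x ∈ xs ] ∑[ y ∈ ys ] f (x , y) ∎

  ∑-reindex : ∀ {A B : Set} {xs : List A} {ys : List B} → Unique xs → Unique ys →
              (bij : ListBijection xs ys) → ∀ f → ∑ ys f ≈ ∑[ x ∈ xs ] f (ListBijection.to bij x)
  ∑-reindex {xs = xs} {ys} xs! ys! bij f = begin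
    ∑ ys f              ≈⟨ ∑-↭ f (↭-sym (map-to-↭ xs! ys! bij)) ⟩
    ∑ (map to xs) f     ≡⟨ ∑-map xs to f ⟩
    ∑[ x ∈ xs ] f (to x) ∎
    where open ListBijection bij

module AdditiveCharacter {c ℓ} (R : CommutativeRing c ℓ) (ζ : CommutativeRing.Carrier R)
                         (C : ℕ) .{{_ : NonZero C}}
                         (ζ^C≈1 : CommutativeRing._≈_ R (pow R ζ C) (CommutativeRing.1# R)) where

  open CommutativeRing R renaming (refl to ≈-refl; sym to ≈-sym; trans to ≈-trans; reflexive to ≈-reflexive)
  open import Relation.Binary.Reasoning.Setoid setoid
  open Exp R ζ C using (e)

  pow-+ : ∀ m n → pow R ζ (m ℕ.+ n) ≈ pow R ζ m * pow R ζ n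
  pow-+ zero    n = ≈-sym (*-identityˡ _)
  pow-+ (suc m) n = ≈-trans (*-congˡ (pow-+ m n)) (≈-sym (*-assoc ζ _ _))

  pow-multiple : ∀ q → pow R ζ (q ℕ.* C) ≈ 1#
  pow-multiple zero    = ≈-refl
  pow-multiple (suc q) = begin
    pow R ζ (C ℕ.+ q ℕ.* C)          ≈⟨ pow-+ C (q ℕ.* C) ⟩
    pow R ζ C * pow R ζ (q ℕ.* C)    ≈⟨ *-cong ζ^C≈1 (pow-multiple q) ⟩
    1# * 1#                          ≈⟨ *-identityˡ 1# ⟩
    1#                               ∎

  pow-% : ∀ n → pow R ζ n ≈ pow R ζ (n ℕ.% C)
  pow-% n = begin
    pow R ζ n                                       ≡⟨ cong (pow R ζ) (ℕDM.m≡m%n+[m/n]*n n C) ⟩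
    pow R ζ (n ℕ.% C ℕ.+ (n ℕ./ C) ℕ.* C)           ≈⟨ pow-+ (n ℕ.% C) _ ⟩
    pow R ζ (n ℕ.% C) * pow R ζ ((n ℕ./ C) ℕ.* C)   ≈⟨ *-congˡ (pow-multiple (n ℕ./ C)) ⟩
    pow R ζ (n ℕ.% C) * 1#                          ≈⟨ *-identityʳ _ ⟩
    pow R ζ (n ℕ.% C)                               ∎

  E : ℤ → Carrier
  E t = pow R ζ (resℤ t C)

  E-cong : ∀ {s t} → s ≡ t mod C → E s ≡ E t
  E-cong s≡t = cong (pow R ζ) (resℤ-cong s≡t)

  pow≈E : ∀ n → pow R ζ n ≈ E (+ n)
  pow≈E n = ≈-trans (pow-% n) (≈-reflexive (cong (pow R ζ) (sym (resℤ-unique (ℕDM.m%n<n n C) n%C≡n))))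
    where
    n%C≡n : + (n ℕ.% C) ≡ + n mod C
    n%C≡n = ≡-mod-sym (≡-mod-trans (≡-mod-reflexive (cong +_ (ℕDM.m≡m%n+[m/n]*n n C)))
                                   (ℕ-multiple≡ _ (n ℕ./ C)))

  E-+ : ∀ s t → E (s ℤ.+ t) ≈ E s * E t
  E-+ s t = begin
    E (s ℤ.+ t)                       ≡⟨ E-cong (+-cong-mod (≡-mod-sym (resℤ≡ s)) (≡-mod-sym (resℤ≡ t))) ⟩
    E (+ resℤ s C ℤ.+ + resℤ t C)     ≡⟨ cong E (ℤP.pos-+ (resℤ s C) (resℤ t C)) ⟨
    E (+ (resℤ s C ℕ.+ resℤ t C))     ≈⟨ pow≈E _ ⟨
    pow R ζ (resℤ s C ℕ.+ resℤ t C)   ≈⟨ pow-+ (resℤ s C) (resℤ t C) ⟩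
    E s * E t                         ∎

  e≈E : ∀ {N} .{{_ : NonZero N}} q t → q ℕ.* N ≡ C → e t N ≈ E (+ q ℤ.* t)
  e≈E {suc k} q t qN≡C = begin
    pow R ζ (divℕ C (suc k) ℕ.* resℤ t (suc k))
      ≡⟨ cong (λ m → pow R ζ (m ℕ.* resℤ t (suc k))) C/N≡q ⟩
    pow R ζ (q ℕ.* resℤ t (suc k))
      ≈⟨ pow≈E _ ⟩
    E (+ (q ℕ.* resℤ t (suc k)))
      ≡⟨ E-cong (≡-mod-trans (≡-mod-reflexive (ℤP.pos-* q _)) qr≡qt) ⟩
    E (+ q ℤ.* t) ∎
    where
    C/N≡q : divℕ C (suc k) ≡ q
    C/N≡q = trans (cong (ℕ._/ suc k) (sym qN≡C)) (ℕDM.m*n/n≡m q (suc k))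
    qr≡qt : + q ℤ.* + resℤ t (suc k) ≡ + q ℤ.* t mod C
    qr≡qt = subst (λ M → _ ≡ _ mod M) qN≡C (≡-mod-scale q (resℤ≡ t))

  e-C≈E : ∀ t → e t C ≈ E t
  e-C≈E t = ≈-trans (e≈E 1 t (ℕP.*-identityˡ C)) (≈-reflexive (cong E (ℤP.*-identityˡ t)))

-- c times the phases of the (x, y)-term of 𝒮 and of the (u, x′, y′)-term of S · cT; a variable
-- ending in ⁻¹ stands for the inverse of its namesake modulo the relevant modulus.
module Exponents (h n m D L D⁻¹ L⁻¹ : ℤ) where

  open import Data.Integer.Base using (0ℤ; 1ℤ; _+_; _*_; _-_; -_)

  lhsExponent : (X X⁻¹ Y Y⁻¹ : ℤ) → ℤ
  lhsExponent X X⁻¹ Y Y⁻¹ = L * (m * Y + X * Y⁻¹) + (h * X⁻¹ - n * X)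

  rhsExponent : (U U⁻¹ X′ X′⁻¹ Y′ Y′⁻¹ : ℤ) → ℤ
  rhsExponent U U⁻¹ X′ X′⁻¹ Y′ Y′⁻¹ =
    D * (h * U + - n * (D⁻¹ * D⁻¹) * U⁻¹)
      + (L * ((X′⁻¹ + n * L⁻¹) * Y′ + - (h * L⁻¹) * Y′⁻¹) + L * - (m * X′))

  module _ {N : ℕ} where

    open ≡-mod-Reasoning N

    lhsExponent-cong : ∀ {X X⁻¹ Z Z⁻¹} Y Y⁻¹ → X ≡ Z mod N → X⁻¹ ≡ Z⁻¹ mod N →
                       lhsExponent X X⁻¹ Y Y⁻¹ ≡ lhsExponent Z Z⁻¹ Y Y⁻¹ mod N
    lhsExponent-cong Y Y⁻¹ X≡Z X⁻¹≡Z⁻¹ =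
      +-cong-mod (*-congˡ-mod L (+-congˡ-mod (m * Y) (*-congʳ-mod Y⁻¹ X≡Z)))
                 (-‿cong-mod (*-congˡ-mod h X⁻¹≡Z⁻¹) (*-congˡ-mod n X≡Z))

    lhsExponent≡-mod-L : ∀ A A⁻¹ Y Y⁻¹ → L ≡ 0ℤ mod N →
                         lhsExponent A A⁻¹ Y Y⁻¹ ≡ h * A⁻¹ - n * A mod N
    lhsExponent≡-mod-L A A⁻¹ Y Y⁻¹ L≡0 = begin
      L * (m * Y + A * Y⁻¹) + (h * A⁻¹ - n * A)
        ≈⟨ +-congʳ-mod (h * A⁻¹ - n * A) (*-congʳ-mod (m * Y + A * Y⁻¹) L≡0) ⟩
      0ℤ + (h * A⁻¹ - n * A)
        ≡⟨ ℤP.+-identityˡ _ ⟩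
      h * A⁻¹ - n * A ∎

    rhsExponent≡-mod-L : ∀ {A A⁻¹ U U⁻¹} X′ X′⁻¹ Y′ Y′⁻¹ →
                         L ≡ 0ℤ mod N → D * D⁻¹ ≡ 1ℤ mod N →
                         U ≡ D⁻¹ * A⁻¹ mod N → U⁻¹ ≡ D * A mod N →
                         rhsExponent U U⁻¹ X′ X′⁻¹ Y′ Y′⁻¹ ≡ h * A⁻¹ - n * A mod N
    rhsExponent≡-mod-L {A} {A⁻¹} {U} {U⁻¹} X′ X′⁻¹ Y′ Y′⁻¹ L≡0 DD⁻¹≡1 U≡ U⁻¹≡ = begin
      rhsExponent U U⁻¹ X′ X′⁻¹ Y′ Y′⁻¹
        ≈⟨ +-cong-mod (*-congˡ-mod D (+-cong-mod (*-congˡ-mod h U≡)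
                                                  (*-congˡ-mod (- n * (D⁻¹ * D⁻¹)) U⁻¹≡)))
                      (+-cong-mod (*-congʳ-mod Q L≡0) (*-congʳ-mod (- (m * X′)) L≡0)) ⟩
      D * (h * (D⁻¹ * A⁻¹) + - n * (D⁻¹ * D⁻¹) * (D * A)) + 0ℤ
        ≡⟨ solve (D ∷ D⁻¹ ∷ h ∷ n ∷ A ∷ A⁻¹ ∷ []) ⟩
      (D * D⁻¹) * (h * A⁻¹) - ((D * D⁻¹) * (D * D⁻¹)) * (n * A)
        ≈⟨ -‿cong-mod (*-congʳ-mod (h * A⁻¹) DD⁻¹≡1)
                      (*-congʳ-mod (n * A) (*-cong-mod DD⁻¹≡1 DD⁻¹≡1)) ⟩
      1ℤ * (h * A⁻¹) - (1ℤ * 1ℤ) * (n * A)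
        ≡⟨ solve (h ∷ A⁻¹ ∷ n ∷ A ∷ []) ⟩
      h * A⁻¹ - n * A ∎
      where Q = (X′⁻¹ + n * L⁻¹) * Y′ + - (h * L⁻¹) * Y′⁻¹

    rhsExponent≡-mod-D : ∀ {B B⁻¹ Y Y⁻¹ X′ X′⁻¹ Y′ Y′⁻¹} U U⁻¹ →
                         D ≡ 0ℤ mod N → L * L⁻¹ ≡ 1ℤ mod N →
                         X′ ≡ - Y mod N → X′⁻¹ ≡ - Y⁻¹ mod N →
                         Y′ ≡ - B mod N → Y′⁻¹ ≡ - B⁻¹ mod N →
                         rhsExponent U U⁻¹ X′ X′⁻¹ Y′ Y′⁻¹ ≡ lhsExponent B B⁻¹ Y Y⁻¹ mod N
    rhsExponent≡-mod-D {B} {B⁻¹} {Y} {Y⁻¹} {X′} {X′⁻¹} {Y′} {Y′⁻¹} U U⁻¹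
                       D≡0 LL⁻¹≡1 X′≡ X′⁻¹≡ Y′≡ Y′⁻¹≡ = begin
      rhsExponent U U⁻¹ X′ X′⁻¹ Y′ Y′⁻¹
        ≈⟨ +-cong-mod (*-congʳ-mod (h * U + - n * (D⁻¹ * D⁻¹) * U⁻¹) D≡0)
                      (+-cong-mod (*-congˡ-mod L (+-cong-mod (*-cong-mod (+-congʳ-mod (n * L⁻¹) X′⁻¹≡) Y′≡)
                                                              (*-congˡ-mod (- (h * L⁻¹)) Y′⁻¹≡)))
                                  (*-congˡ-mod L (neg-cong-mod (*-congˡ-mod m X′≡)))) ⟩
      0ℤ + (L * ((- Y⁻¹ + n * L⁻¹) * - B + - (h * L⁻¹) * - B⁻¹) + L * - (m * - Y))
        ≡⟨ solve (L ∷ L⁻¹ ∷ h ∷ n ∷ m ∷ B ∷ B⁻¹ ∷ Y ∷ Y⁻¹ ∷ []) ⟩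
      L * (m * Y + B * Y⁻¹) + (L * L⁻¹) * (h * B⁻¹ - n * B)
        ≈⟨ +-congˡ-mod (L * (m * Y + B * Y⁻¹)) (*-congʳ-mod (h * B⁻¹ - n * B) LL⁻¹≡1) ⟩
      L * (m * Y + B * Y⁻¹) + 1ℤ * (h * B⁻¹ - n * B)
        ≡⟨ cong (λ t → L * (m * Y + B * Y⁻¹) + t) (ℤP.*-identityˡ _) ⟩
      lhsExponent B B⁻¹ Y Y⁻¹ ∎

module ChineseRemainder (d ℓ : ℕ) .{{_ : NonZero d}} .{{_ : NonZero ℓ}} (d⊥ℓ : Coprime d ℓ) where

  open import Data.Integer.Base using (0ℤ; 1ℤ; _+_; _*_; _-_; -_)

  c : ℕ
  c = d ℕ.* ℓ

  instance
    c-nonZero : NonZero c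
    c-nonZero = ℕP.m*n≢0 d ℓ

  D L D⁻¹ L⁻¹ : ℤ
  D   = + d
  L   = + ℓ
  D⁻¹ = + invℕ ℓ d
  L⁻¹ = + invℕ d ℓ

  DD⁻¹≡1 : D * D⁻¹ ≡ 1ℤ mod ℓ
  DD⁻¹≡1 = proj₂ (invℕ-spec d⊥ℓ)

  LL⁻¹≡1 : L * L⁻¹ ≡ 1ℤ mod d
  LL⁻¹≡1 = proj₂ (invℕ-spec (CP.sym d⊥ℓ))

  reduce-ℓ : ∀ {a b} → a ≡ b mod c → a ≡ b mod ℓ
  reduce-ℓ = ≡-mod-∣ (ℕD.n∣m*n d)

  reduce-d : ∀ {a b} → a ≡ b mod c → a ≡ b mod d
  reduce-d = ≡-mod-∣ (ℕD.m∣m*n ℓ)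

  crtLift : ℤ → ℤ → ℤ
  crtLift a b = a * (D * D⁻¹) + b * (L * L⁻¹)

  crtLift≡-mod-ℓ : ∀ a b → crtLift a b ≡ a mod ℓ
  crtLift≡-mod-ℓ a b = begin
    a * (D * D⁻¹) + b * (L * L⁻¹)
      ≈⟨ +-cong-mod (*-congˡ-mod a DD⁻¹≡1) (*-congˡ-mod b (*-congʳ-mod L⁻¹ modulus≡0)) ⟩
    a * 1ℤ + b * 0ℤ
      ≡⟨ solve (a ∷ b ∷ []) ⟩
    a ∎
    where open ≡-mod-Reasoning ℓ

  crtLift≡-mod-d : ∀ a b → crtLift a b ≡ b mod d
  crtLift≡-mod-d a b = begin
    a * (D * D⁻¹) + b * (L * L⁻¹)
      ≈⟨ +-cong-mod (*-congˡ-mod a (*-congʳ-mod D⁻¹ modulus≡0)) (*-congˡ-mod b LL⁻¹≡1) ⟩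
    a * 0ℤ + b * 1ℤ
      ≡⟨ solve (a ∷ b ∷ []) ⟩
    b ∎
    where open ≡-mod-Reasoning d

  crtLift-inverse : ∀ a a⁻¹ b b⁻¹ → a * a⁻¹ ≡ 1ℤ mod ℓ → b * b⁻¹ ≡ 1ℤ mod d →
                    crtLift a b * crtLift a⁻¹ b⁻¹ ≡ 1ℤ mod c
  crtLift-inverse a a⁻¹ b b⁻¹ aa⁻¹≡1 bb⁻¹≡1 = ≡-mod-crt d⊥ℓ
    (≡-mod-trans (*-cong-mod (crtLift≡-mod-d a b) (crtLift≡-mod-d a⁻¹ b⁻¹)) bb⁻¹≡1)
    (≡-mod-trans (*-cong-mod (crtLift≡-mod-ℓ a b) (crtLift≡-mod-ℓ a⁻¹ b⁻¹)) aa⁻¹≡1)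

  crt : ℕ × ℕ → ℕ
  crt (a , b) = resℤ (crtLift (+ a) (+ b)) c

  crt≡-mod-ℓ : ∀ a b → + crt (a , b) ≡ + a mod ℓ
  crt≡-mod-ℓ a b = ≡-mod-trans (reduce-ℓ (resℤ≡ _)) (crtLift≡-mod-ℓ (+ a) (+ b))

  crt≡-mod-d : ∀ a b → + crt (a , b) ≡ + b mod d
  crt≡-mod-d a b = ≡-mod-trans (reduce-d (resℤ≡ _)) (crtLift≡-mod-d (+ a) (+ b))

  crt-bijection : ListBijection (cartesianProduct (units ℓ) (units d)) (units c)
  crt-bijection = record
    { to      = crt
    ; from    = λ x → resℤ (+ x) ℓ , resℤ (+ x) d
    ; to-∈    = crt-∈
    ; from-∈  = λ x∈units → ∈-cartesianProduct⁺ (resℤ∈units (reduce-ℓ (unit-inverse x∈units)))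
                                                (resℤ∈units (reduce-d (unit-inverse x∈units)))
    ; from∘to = crt-injective
    ; to∘from = crt-surjective
    }
    where
    crt-∈ : ∀ {p} → p ∈ cartesianProduct (units ℓ) (units d) → crt p ∈ units c
    crt-∈ {a , b} p∈ = resℤ∈units (crtLift-inverse (+ a) (+ invℕ ℓ a) (+ b) (+ invℕ d b)
                                                   (unit-inverse (proj₁ ∈-factors)) (unit-inverse (proj₂ ∈-factors)))
      where ∈-factors = ∈-cartesianProduct⁻ (units ℓ) (units d) p∈
    crt-injective : ∀ {p} → p ∈ cartesianProduct (units ℓ) (units d) →
                    (resℤ (+ crt p) ℓ , resℤ (+ crt p) d) ≡ p
    crt-injective {a , b} p∈ = cong₂ _,_
      (resℤ-unique (unit-< (proj₁ ∈-factors)) (≡-mod-sym (crt≡-mod-ℓ a b)))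
      (resℤ-unique (unit-< (proj₂ ∈-factors)) (≡-mod-sym (crt≡-mod-d a b)))
      where ∈-factors = ∈-cartesianProduct⁻ (units ℓ) (units d) p∈
    crt-surjective : ∀ {x} → x ∈ units c → crt (resℤ (+ x) ℓ , resℤ (+ x) d) ≡ x
    crt-surjective {x} x∈units = resℤ-unique (unit-< x∈units) (≡-mod-crt d⊥ℓ
      (≡-mod-sym (≡-mod-trans (crtLift≡-mod-d (+ resℤ (+ x) ℓ) _) (resℤ≡ (+ x))))
      (≡-mod-sym (≡-mod-trans (crtLift≡-mod-ℓ _ (+ resℤ (+ x) d)) (resℤ≡ (+ x)))))

  σ : ℕ → ℕ
  σ = scaledInverse ℓ D D⁻¹ DD⁻¹≡1

  σ-bijection : ListBijection (units ℓ) (units ℓ)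
  σ-bijection = scaledInverse-bijection ℓ D D⁻¹ DD⁻¹≡1

  module _ (h n m : ℤ) where

    open Exponents h n m D L D⁻¹ L⁻¹

    lhsE : ℕ → ℕ → ℤ
    lhsE x y = lhsExponent (+ x) (+ invℕ c x) (+ y) (+ invℕ d y)

    rhsE : ℕ → ℕ → ℕ → ℤ
    rhsE u x′ y′ = rhsExponent (+ u) (+ invℕ ℓ u) (+ x′) (+ invℕ d x′) (+ y′) (+ invℕ d y′)

    exponent-match : ∀ {a b y} → a ∈ units ℓ → b ∈ units d → y ∈ units d →
                     lhsE (crt (a , b)) y ≡ rhsE (σ a) (negate d y) (negate d b) mod c
    exponent-match {a} {b} {y} a∈units b∈units y∈units = ≡-mod-crt d⊥ℓ match-mod-d match-mod-ℓ
      where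
      x  = crt (a , b)
      u  = σ a
      x′ = negate d y
      y′ = negate d b
      x∈units = ListBijection.to-∈ crt-bijection (∈-cartesianProduct⁺ a∈units b∈units)

      match-mod-d : lhsE x y ≡ rhsE u x′ y′ mod d
      match-mod-d = begin
        lhsE x y
          ≈⟨ lhsExponent-cong (+ y) (+ invℕ d y) (crt≡-mod-d a b) x⁻¹≡b⁻¹ ⟩
        lhsExponent (+ b) (+ invℕ d b) (+ y) (+ invℕ d y)
          ≈⟨ rhsExponent≡-mod-D (+ u) (+ invℕ ℓ u) modulus≡0 LL⁻¹≡1
                                (resℤ≡ (- + y)) (negate-inverse d y∈units)
                                (resℤ≡ (- + b)) (negate-inverse d b∈units) ⟨
        rhsE u x′ y′ ∎
        where
        open ≡-mod-Reasoning d
        x⁻¹≡b⁻¹ = inverse-unique (crt≡-mod-d a b) (reduce-d (unit-inverse x∈units)) (unit-inverse b∈units)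

      match-mod-ℓ : lhsE x y ≡ rhsE u x′ y′ mod ℓ
      match-mod-ℓ = begin
        lhsE x y
          ≈⟨ lhsExponent-cong (+ y) (+ invℕ d y) (crt≡-mod-ℓ a b) x⁻¹≡a⁻¹ ⟩
        lhsExponent (+ a) (+ invℕ ℓ a) (+ y) (+ invℕ d y)
          ≈⟨ lhsExponent≡-mod-L (+ a) _ (+ y) _ modulus≡0 ⟩
        h * + invℕ ℓ a - n * + a
          ≈⟨ rhsExponent≡-mod-L (+ x′) (+ invℕ d x′) (+ y′) (+ invℕ d y′) modulus≡0 DD⁻¹≡1
                                (resℤ≡ (D⁻¹ * + invℕ ℓ a)) (scaledInverse-inverse ℓ D D⁻¹ DD⁻¹≡1 a∈units) ⟨
        rhsE u x′ y′ ∎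
        where
        open ≡-mod-Reasoning ℓ
        x⁻¹≡a⁻¹ = inverse-unique (crt≡-mod-ℓ a b) (reduce-ℓ (unit-inverse x∈units)) (unit-inverse a∈units)

module Expansion {r r′} (R : CommutativeRing r r′) (ζ : CommutativeRing.Carrier R)
                 (d ℓ : ℕ) .{{_ : NonZero d}} .{{_ : NonZero ℓ}} (d⊥ℓ : Coprime d ℓ)
                 (ζ^c≈1 : CommutativeRing._≈_ R (pow R ζ (d ℕ.* ℓ)) (CommutativeRing.1# R))
                 (h n m : ℤ) where

  open CommutativeRing R renaming (refl to ≈-refl; sym to ≈-sym; trans to ≈-trans; reflexive to ≈-reflexive)
  open import Relation.Binary.Reasoning.Setoid setoid
  open ChineseRemainder d ℓ d⊥ℓ
  open AdditiveCharacter R ζ c ζ^c≈1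
  open Exp R ζ c
  open Sums R

  e-d≈E : ∀ t → e t d ≈ E (L ℤ.* t)
  e-d≈E t = e≈E ℓ t (ℕP.*-comm ℓ d)

  e-ℓ≈E : ∀ t → e t ℓ ≈ E (D ℤ.* t)
  e-ℓ≈E t = e≈E d t refl

  tripleSum : Carrier
  tripleSum = ∑[ a ∈ units ℓ ] ∑[ y ∈ units d ] ∑[ b ∈ units d ] E (lhsE h n m (crt (a , b)) y)

  lhs-summand : ∀ x → S m (+ x) d * e (h ℤ.* + invℕ c x ℤ.- n ℤ.* + x) c
                      ≈ ∑[ y ∈ units d ] E (lhsE h n m x y)
  lhs-summand x = begin
    S m (+ x) d * e t c                      ≡⟨ cong (λ z → z * e t c) (sumL≡∑ (units d) _) ⟩
    (∑[ y ∈ units d ] e (s y) d) * e t c     ≈⟨ ∑-*ʳ (units d) _ (e t c) ⟩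
    ∑[ y ∈ units d ] (e (s y) d * e t c)     ≈⟨ ∑-cong (units d) (λ {y} _ →
                                                  ≈-trans (*-cong (e-d≈E (s y)) (e-C≈E t)) (≈-sym (E-+ _ t))) ⟩
    ∑[ y ∈ units d ] E (lhsE h n m x y)      ∎
    where
    s : ℕ → ℤ
    s y = m ℤ.* + y ℤ.+ + x ℤ.* + invℕ d y
    t = h ℤ.* + invℕ c x ℤ.- n ℤ.* + x

  𝒮≈tripleSum : 𝒮 h n m c d ≈ tripleSum
  𝒮≈tripleSum = begin
    𝒮 h n m c d
      ≡⟨ sumL≡∑ (units c) _ ⟩
    ∑[ x ∈ units c ] (S m (+ x) d * e (h ℤ.* + invℕ c x ℤ.- n ℤ.* + x) c)
      ≈⟨ ∑-cong (units c) (λ {x} _ → lhs-summand x) ⟩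
    ∑[ x ∈ units c ] ∑[ y ∈ units d ] E (lhsE h n m x y)
      ≈⟨ ∑-reindex (cartesianProduct⁺ (units-unique ℓ) (units-unique d)) (units-unique c) crt-bijection _ ⟩
    ∑[ p ∈ cartesianProduct (units ℓ) (units d) ] ∑[ y ∈ units d ] E (lhsE h n m (crt p) y)
      ≈⟨ ∑-cartesianProduct (units ℓ) (units d) _ ⟩
    ∑[ a ∈ units ℓ ] ∑[ b ∈ units d ] ∑[ y ∈ units d ] E (lhsE h n m (crt (a , b)) y)
      ≈⟨ ∑-cong (units ℓ) (λ _ → ∑-comm (units d) (units d) _) ⟩
    tripleSum ∎

  rhs-summand : ∀ u x′ →
    e (h ℤ.* + u ℤ.+ (ℤ.- n ℤ.* (D⁻¹ ℤ.* D⁻¹)) ℤ.* + invℕ ℓ u) ℓ *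
      (S (+ invℕ d x′ ℤ.+ n ℤ.* L⁻¹) (ℤ.- (h ℤ.* L⁻¹)) d * e (ℤ.- (m ℤ.* + x′)) d)
    ≈ ∑[ y′ ∈ units d ] E (rhsE h n m u x′ y′)
  rhs-summand u x′ = begin
    e p ℓ * (S (+ invℕ d x′ ℤ.+ n ℤ.* L⁻¹) (ℤ.- (h ℤ.* L⁻¹)) d * e t d)
      ≡⟨ cong (λ z → e p ℓ * (z * e t d)) (sumL≡∑ (units d) _) ⟩
    e p ℓ * ((∑[ y′ ∈ units d ] e (q y′) d) * e t d)
      ≈⟨ *-congˡ (∑-*ʳ (units d) _ (e t d)) ⟩
    e p ℓ * ∑[ y′ ∈ units d ] (e (q y′) d * e t d)
      ≈⟨ ∑-*ˡ (units d) _ (e p ℓ) ⟩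
    ∑[ y′ ∈ units d ] (e p ℓ * (e (q y′) d * e t d))
      ≈⟨ ∑-cong (units d) (λ {y′} _ → begin
           e p ℓ * (e (q y′) d * e t d)                      ≈⟨ *-cong (e-ℓ≈E p) (*-cong (e-d≈E (q y′)) (e-d≈E t)) ⟩
           E (D ℤ.* p) * (E (L ℤ.* q y′) * E (L ℤ.* t))      ≈⟨ *-congˡ (E-+ _ _) ⟨
           E (D ℤ.* p) * E (L ℤ.* q y′ ℤ.+ L ℤ.* t)          ≈⟨ E-+ _ _ ⟨
           E (rhsE h n m u x′ y′)                            ∎) ⟩
    ∑[ y′ ∈ units d ] E (rhsE h n m u x′ y′)                 ∎
    where
    p = h ℤ.* + u ℤ.+ (ℤ.- n ℤ.* (D⁻¹ ℤ.* D⁻¹)) ℤ.* + invℕ ℓ u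
    q : ℕ → ℤ
    q y′ = (+ invℕ d x′ ℤ.+ n ℤ.* L⁻¹) ℤ.* + y′ ℤ.+ (ℤ.- (h ℤ.* L⁻¹)) ℤ.* + invℕ d y′
    t = ℤ.- (m ℤ.* + x′)

  S*cT≈tripleSum : S h (ℤ.- n ℤ.* (D⁻¹ ℤ.* D⁻¹)) ℓ * cT (n ℤ.* L⁻¹) (h ℤ.* L⁻¹) m d ≈ tripleSum
  S*cT≈tripleSum = begin
    S h (ℤ.- n ℤ.* (D⁻¹ ℤ.* D⁻¹)) ℓ * cT (n ℤ.* L⁻¹) (h ℤ.* L⁻¹) m d
      ≡⟨ cong₂ _*_ (sumL≡∑ (units ℓ) _) (sumL≡∑ (units d) _) ⟩
    ∑ (units ℓ) _ * ∑ (units d) _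
      ≈⟨ ∑-*ʳ (units ℓ) _ _ ⟩
    ∑[ u ∈ units ℓ ] (_ * ∑ (units d) _)
      ≈⟨ ∑-cong (units ℓ) (λ {u} _ → ≈-trans (∑-*ˡ (units d) _ _)
                                             (∑-cong (units d) (λ {x′} _ → rhs-summand u x′))) ⟩
    ∑[ u ∈ units ℓ ] ∑[ x′ ∈ units d ] ∑[ y′ ∈ units d ] E (rhsE h n m u x′ y′)
      ≈⟨ ∑-reindex (units-unique ℓ) (units-unique ℓ) σ-bijection _ ⟩
    ∑[ a ∈ units ℓ ] ∑[ x′ ∈ units d ] ∑[ y′ ∈ units d ] E (rhsE h n m (σ a) x′ y′)
      ≈⟨ ∑-cong (units ℓ) (λ _ → ≈-trans (reindex-negate _) (∑-cong (units d) (λ _ → reindex-negate _))) ⟩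
    ∑[ a ∈ units ℓ ] ∑[ y ∈ units d ] ∑[ b ∈ units d ] E (rhsE h n m (σ a) (negate d y) (negate d b))
      ≈⟨ ∑-cong (units ℓ) (λ a∈units → ∑-cong (units d) (λ y∈units → ∑-cong (units d) (λ b∈units →
           ≈-reflexive (E-cong (≡-mod-sym (exponent-match h n m a∈units b∈units y∈units)))))) ⟩
    tripleSum ∎
    where
    reindex-negate : ∀ f → ∑ (units d) f ≈ ∑[ y ∈ units d ] f (negate d y)
    reindex-negate = ∑-reindex (units-unique d) (units-unique d) (negate-bijection d)

lemma3p3 : ∀ {a b} (R : CommutativeRing a b) → NoZeroDivisors R →
    (d ℓ : ℕ) → 1 ℕ.≤ d → 1 ℕ.≤ ℓ → Coprime d ℓ →
    (ζ : CommutativeRing.Carrier R) → ExactOrder R ζ (d ℕ.* ℓ) →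
    (h n m : ℤ) →
    let open CommutativeRing R
        open Exp R ζ (d ℕ.* ℓ)
        c = d ℕ.* ℓ
        dbar = inv ℓ d
        ℓbar = inv d ℓ
    in 𝒮 h n m c d ≈ S h (ℤ.- n ℤ.* (dbar ℤ.* dbar)) ℓ * cT (n ℤ.* ℓbar) (h ℤ.* ℓbar) m d
lemma3p3 R _ d ℓ 1≤d 1≤ℓ d⊥ℓ ζ (ζ^c≈1 , _) h n m =
  ≈-trans 𝒮≈tripleSum (≈-sym S*cT≈tripleSum)
  where
  open CommutativeRing R using () renaming (trans to ≈-trans; sym to ≈-sym)
  instance
    _ = >-nonZero 1≤d
    _ = >-nonZero 1≤ℓ
  open Expansion R ζ d ℓ d⊥ℓ ζ^c≈1 h n m
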